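{- Let $D$ be a hook diagram. If $D'=D\big\downarrow^{(r,c)}_{(r-k,c)}$ for some $k\ge1$ and $D'$ is covered by $D$ in $\mathcal{P}(D)$ (no diagram $\tilde D$ with $D'\prec\tilde D\prec D$), then $k=1$.
   Context: A diagram is a finite set of cells in $\mathbb{Z}_{>0}\times\mathbb{Z}_{>0}$; a cell $(r,c)$ lies in row $r$ (rows numbered from the bottom, starting at $1$) and column $c$. Applying a Kohnert move at row $r$ of a diagram $D$: if row $r$ is nonempty, let $(r,c)$ be its rightmost cell; if there is $r'$ with $1\le r'<r$ and $(r',c)\notin D$, take the largest such $r'$ and replace $(r,c)$ by $(r',c)$; otherwise $D$ is unchanged. When a Kohnert move at row $r$ of $D$ moves $(r,c)$ to $(r',c)$, producing $D'$, one writes $D'=D\big\downarrow^{(r,c)}_{(r',c)}$. $KD(D)$ is the set of diagrams obtainable from $D$ by finite (possibly empty) sequences of Kohnert moves; $\mathcal{P}(D)$ is $KD(D)$ with $D_2\preceq D_1$ iff $D_2$ can be obtained from $D_1$ by Kohnert moves. For positive integers $r_1\le r_2$ and a finite nonempty $C=\{c_1,\dots,c_m\}\subset\mathbb{Z}_{>0}$ with $c_m=\max C$, $H(r_1,r_2;C)=\{(r_2,c_i)\mid 1\le i\le m\}\cup\{(j,c_m)\mid r_1\le j\le r_2\}$. A hook diagram is a diagram lying in $KD(H(r_1,r_2;C))$ for some such $r_1,r_2,C$. -}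

module Defs where

open import Data.Nat using (ℕ; zero; suc; _+_; _∸_; _≤_; _<_; _⊔_)
open import Data.Product using (_×_; _,_; ∃; ∃-syntax)
open import Data.Sum using (_⊎_)
open import Data.List using (List; []; _∷_; map; _++_; foldr; upTo)
open import Data.List.Membership.Propositional using (_∈_)
open import Relation.Binary.PropositionalEquality using (_≡_; _≢_)
open import Relation.Nullary using (¬_)
open import Data.Unit using (⊤)

-- A cell (r , c): row r (numbered from the bottom), column c.
Cell : Set
Cell = ℕ × ℕ

-- A diagram is a finite set of cells, represented by a list of cells
-- (order and multiplicity are irrelevant; equality is equality of
-- the underlying sets, see _≋_).
Diagram : Set
Diagram = List Cell

_≋_ : Diagram → Diagram → Set
D ≋ E = ∀ p → (p ∈ D → p ∈ E) × (p ∈ E → p ∈ D)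

-- Kohnert D r c r' D' : a Kohnert move at row r of D is nontrivial,
-- moves its rightmost cell (r , c) to (r' , c), and D' is the result,
-- i.e. D' = D ↓^{(r,c)}_{(r',c)}.
record Kohnert (D : Diagram) (r c r' : ℕ) (D' : Diagram) : Set where
  field
    cell-in     : (r , c) ∈ D
    rightmost   : ∀ c' → c < c' → ¬ ((r , c') ∈ D)
    target-pos  : 1 ≤ r'
    target-below : r' < r
    target-empty : ¬ ((r' , c) ∈ D)
    target-max  : ∀ j → r' < j → j < r → (j , c) ∈ D
    result      : ∀ p → (p ∈ D' → ((p ∈ D × p ≢ (r , c)) ⊎ p ≡ (r' , c)))
                      × (((p ∈ D × p ≢ (r , c)) ⊎ p ≡ (r' , c)) → p ∈ D')

-- D₂ ⪯ D₁ : D₂ can be obtained from D₁ by a finite (possibly empty)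
-- sequence of Kohnert moves.  (Kohnert moves leaving the diagram
-- unchanged are covered by the empty sequence.)
data _⪯_ (D₂ : Diagram) : Diagram → Set where
  done : ∀ {D₁} → D₂ ≋ D₁ → D₂ ⪯ D₁
  step : ∀ {D₁ D r c r'} → Kohnert D₁ r c r' D → D₂ ⪯ D → D₂ ⪯ D₁

_≺_ : Diagram → Diagram → Set
D₂ ≺ D₁ = (D₂ ⪯ D₁) × ¬ (D₂ ≋ D₁)

CoveredBy : Diagram → Diagram → Set
CoveredBy D' D = (D' ≺ D) × ¬ (∃[ E ] ((D' ≺ E) × (E ≺ D)))

maxList : ℕ → List ℕ → ℕ
maxList c cs = foldr _⊔_ c cs

-- H(r₁, r₂; C) with C = {c} ∪ cs (nonempty), c_m = max C
Hook : ℕ → ℕ → ℕ → List ℕ → Diagram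
Hook r₁ r₂ c cs =
  map (λ x → (r₂ , x)) (c ∷ cs)
  ++ map (λ i → (r₁ + i , maxList c cs)) (upTo (suc (r₂ ∸ r₁)))

AllPos : List ℕ → Set
AllPos [] = ⊤
AllPos (x ∷ xs) = (1 ≤ x) × AllPos xs

IsHookDiagram : Diagram → Set
IsHookDiagram D =
  ∃[ r₁ ] ∃[ r₂ ] ∃[ c ] ∃[ cs ]
    ((1 ≤ r₁) × (r₁ ≤ r₂) × (1 ≤ c) × AllPos cs × (D ⪯ Hook r₁ r₂ c cs))

-- Hook diagrams satisfy an invariant for m = max C: every cell lies in a
-- column ≤ m, and each column < m holds at most one cell; Kohnert moves
-- preserve it.  If the Kohnert move of (r , c) skips k ≥ 2 rows, then
-- (r-1 , c) is a cell too, so column c holds two cells, forcing c ≥ m and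
-- making (r-1 , c) the rightmost cell of its row.  The move then factors
-- through an intermediate diagram: first move (r-1 , c) down to (r-k , c),
-- then (r , c) down to (r-1 , c).  So D' is not covered by D.
module Submission where

open import Defs
open import Data.Nat using (ℕ; zero; suc; _+_; _∸_; _≤_; _<_; s≤s; _≟_; _≤?_)
open import Data.Nat.Properties
open import Data.Product using (_×_; _,_; ∃-syntax; proj₁; proj₂)
open import Data.Product.Properties using (≡-dec)
open import Data.Sum using (_⊎_; inj₁; inj₂; [_,_])
open import Data.List using ([]; _∷_; map; filter)
open import Data.List.Membership.Propositional using (_∈_; _∉_)
open import Data.List.Membership.Propositional.Properties
  using (∈-++⁻; ∈-map⁻; ∈-filter⁻; ∈-filter⁺)
open import Data.List.Relation.Unary.Any using (here; there)
open import Data.Empty using (⊥-elim)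
open import Function using (_∘_)
open import Relation.Binary.Definitions using (DecidableEquality)
open import Relation.Binary.PropositionalEquality using (_≡_; _≢_; refl; cong)
open import Relation.Nullary using (¬_; ¬?; yes; no)

≋-refl : ∀ {D} → D ≋ D
≋-refl _ = (λ p → p) , (λ p → p)

row-≢ : ∀ {a b x y : ℕ} → a ≢ b → (a , x) ≢ (b , y)
row-≢ a≢b = a≢b ∘ cong proj₁

Kohnert⇒≺ : ∀ {D D' r c r'} → Kohnert D r c r' D' → D' ≺ D
Kohnert⇒≺ K = step K (done ≋-refl) , λ D'≋D →
  target-empty (proj₁ (D'≋D _) (proj₂ (result _) (inj₂ refl)))
  where open Kohnert K

_≟ᶜ_ : DecidableEquality Cell
_≟ᶜ_ = ≡-dec _≟_ _≟_

move : Diagram → Cell → Cell → Diagram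
move D p q = q ∷ filter (λ x → ¬? (x ≟ᶜ p)) D

∈-move⁻ : ∀ D {p q x} → x ∈ move D p q → (x ∈ D × x ≢ p) ⊎ x ≡ q
∈-move⁻ _ (here x≡q) = inj₂ x≡q
∈-move⁻ _ (there x∈) = inj₁ (∈-filter⁻ _ x∈)

∈-move⁺ : ∀ {D p q x} → x ∈ D → x ≢ p → x ∈ move D p q
∈-move⁺ x∈D x≢p = there (∈-filter⁺ _ x∈D x≢p)

module _ {D D' n c t} (K : Kohnert D (suc n) c t D') (t<n : t < n)
         (rightmost-below : ∀ c' → c < c' → (n , c') ∉ D) where

  open Kohnert K

  private
    E : Diagram
    E = move D (n , c) (t , c)

    below-in : (n , c) ∈ D
    below-in = target-max n t<n (n<1+n n)

    lower : Kohnert D n c t E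
    lower = record
      { cell-in      = below-in
      ; rightmost    = rightmost-below
      ; target-pos   = target-pos
      ; target-below = t<n
      ; target-empty = target-empty
      ; target-max   = λ j t<j j<n → target-max j t<j (m<n⇒m<1+n j<n)
      ; result       = λ p → ∈-move⁻ D , [ (λ (p∈D , p≢) → ∈-move⁺ p∈D p≢) , (λ { refl → here refl }) ]
      }

    upper : Kohnert E (suc n) c n D'
    upper = record
      { cell-in      = ∈-move⁺ cell-in (row-≢ 1+n≢n)
      ; rightmost    = upper-rightmost
      ; target-pos   = ≤-trans target-pos (<⇒≤ t<n)
      ; target-below = n<1+n n
      ; target-empty = upper-target-empty
      ; target-max   = λ j n<j j<1+n → ⊥-elim (<-irrefl refl (<-≤-trans n<j (≤-pred j<1+n)))
      ; result       = λ p → to p , from p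
      }
      where
      upper-rightmost : ∀ c' → c < c' → (suc n , c') ∉ E
      upper-rightmost c' c<c' q with ∈-move⁻ D q
      ... | inj₁ (q' , _) = rightmost c' c<c' q'
      ... | inj₂ eq       = row-≢ (>⇒≢ target-below) eq

      upper-target-empty : (n , c) ∉ E
      upper-target-empty q with ∈-move⁻ D q
      ... | inj₁ (_ , n≢n) = n≢n refl
      ... | inj₂ eq        = row-≢ (>⇒≢ t<n) eq

      to : ∀ p → p ∈ D' → (p ∈ E × p ≢ (suc n , c)) ⊎ p ≡ (n , c)
      to p q with proj₁ (result p) q
      ... | inj₂ refl = inj₁ (here refl , row-≢ (<⇒≢ target-below))
      ... | inj₁ (p∈D , p≢) with p ≟ᶜ (n , c)
      ...   | yes p≡ = inj₂ p≡
      ...   | no p≢' = inj₁ (∈-move⁺ p∈D p≢' , p≢)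

      from : ∀ p → (p ∈ E × p ≢ (suc n , c)) ⊎ p ≡ (n , c) → p ∈ D'
      from p (inj₂ refl) = proj₂ (result p) (inj₁ (below-in , row-≢ (<⇒≢ (n<1+n n))))
      from p (inj₁ (q , p≢)) with ∈-move⁻ D q
      ... | inj₁ (p∈D , _) = proj₂ (result p) (inj₁ (p∈D , p≢))
      ... | inj₂ p≡        = proj₂ (result p) (inj₂ p≡)

  Kohnert-skip⇒¬CoveredBy : ¬ CoveredBy D' D
  Kohnert-skip⇒¬CoveredBy (_ , nothing-between) =
    nothing-between (E , Kohnert⇒≺ upper , Kohnert⇒≺ lower)

record HookShaped (m : ℕ) (D : Diagram) : Set where
  field
    column-≤ : ∀ {a x} → (a , x) ∈ D → x ≤ m
    thin     : ∀ {a b x} → (a , x) ∈ D → (b , x) ∈ D → x < m → a ≡ b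

  no-cell-right-of-double : ∀ {a b c} → a ≢ b → (a , c) ∈ D → (b , c) ∈ D
                          → ∀ c' → c < c' → (a , c') ∉ D
  no-cell-right-of-double {c = c} a≢b a∈ b∈ c' c<c' a'∈ with m ≤? c
  ... | yes m≤c = <⇒≱ (<-≤-trans c<c' (column-≤ a'∈)) m≤c
  ... | no m≰c  = a≢b (thin a∈ b∈ (≰⇒> m≰c))

Kohnert-HookShaped : ∀ {m D r c r' D'} → HookShaped m D → Kohnert D r c r' D'
                   → HookShaped m D'
Kohnert-HookShaped {m} {D} {r} {c} {r'} {D'} H K = record { column-≤ = column-≤' ; thin = thin' }
  where
  open Kohnert K
  open HookShaped H

  column-≤' : ∀ {a x} → (a , x) ∈ D' → x ≤ m
  column-≤' p with proj₁ (result _) p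
  ... | inj₁ (q , _) = column-≤ q
  ... | inj₂ refl    = column-≤ cell-in

  -- The moved cell stays in column c, whose only cell in D was (r , c).
  thin' : ∀ {a b x} → (a , x) ∈ D' → (b , x) ∈ D' → x < m → a ≡ b
  thin' p q x<m with proj₁ (result _) p | proj₁ (result _) q
  ... | inj₁ (p' , _)   | inj₁ (q' , _)   = thin p' q' x<m
  ... | inj₁ (p' , p≢)  | inj₂ refl       = ⊥-elim (p≢ (cong (_, c) (thin p' cell-in x<m)))
  ... | inj₂ refl       | inj₁ (q' , q≢)  = ⊥-elim (q≢ (cong (_, c) (thin q' cell-in x<m)))
  ... | inj₂ refl       | inj₂ refl       = refl

⪯-HookShaped : ∀ {m D E} → HookShaped m E → D ⪯ E → HookShaped m D
⪯-HookShaped H (done D≋E) = record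
  { column-≤ = column-≤ ∘ proj₁ (D≋E _)
  ; thin     = λ p q → thin (proj₁ (D≋E _) p) (proj₁ (D≋E _) q)
  }
  where open HookShaped H
⪯-HookShaped H (step K D⪯) = ⪯-HookShaped (Kohnert-HookShaped H K) D⪯

∈⇒≤maxList : ∀ {c y} cs → y ∈ c ∷ cs → y ≤ maxList c cs
∈⇒≤maxList []       (here refl)         = ≤-refl
∈⇒≤maxList (z ∷ zs) (here refl)         = m≤n⇒m≤o⊔n z (∈⇒≤maxList zs (here refl))
∈⇒≤maxList (z ∷ zs) (there (here refl)) = m≤m⊔n z _
∈⇒≤maxList (z ∷ zs) (there (there y∈))  = m≤n⇒m≤o⊔n z (∈⇒≤maxList zs (there y∈))

∈-Hook⁻ : ∀ r₁ r₂ c cs {a x} → (a , x) ∈ Hook r₁ r₂ c cs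
        → (a ≡ r₂ × x ∈ c ∷ cs) ⊎ x ≡ maxList c cs
∈-Hook⁻ r₁ r₂ c cs p with ∈-++⁻ (map (r₂ ,_) (c ∷ cs)) p
... | inj₁ q with ∈-map⁻ (r₂ ,_) q
...   | _ , x∈ , refl = inj₁ (refl , x∈)
∈-Hook⁻ r₁ r₂ c cs p | inj₂ q with ∈-map⁻ (λ i → (r₁ + i , maxList c cs)) q
...   | _ , _ , refl = inj₂ refl

Hook-HookShaped : ∀ r₁ r₂ c cs → HookShaped (maxList c cs) (Hook r₁ r₂ c cs)
Hook-HookShaped r₁ r₂ c cs = record { column-≤ = column-≤ ; thin = thin }
  where
  column-≤ : ∀ {a x} → (a , x) ∈ Hook r₁ r₂ c cs → x ≤ maxList c cs
  column-≤ p with ∈-Hook⁻ r₁ r₂ c cs p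
  ... | inj₁ (_ , x∈) = ∈⇒≤maxList cs x∈
  ... | inj₂ refl     = ≤-refl

  thin : ∀ {a b x} → (a , x) ∈ Hook r₁ r₂ c cs → (b , x) ∈ Hook r₁ r₂ c cs
       → x < maxList c cs → a ≡ b
  thin p q x<m with ∈-Hook⁻ r₁ r₂ c cs p | ∈-Hook⁻ r₁ r₂ c cs q
  ... | inj₂ refl       | _               = ⊥-elim (<-irrefl refl x<m)
  ... | _               | inj₂ refl       = ⊥-elim (<-irrefl refl x<m)
  ... | inj₁ (refl , _) | inj₁ (refl , _) = refl

IsHookDiagram⇒HookShaped : ∀ {D} → IsHookDiagram D → ∃[ m ] HookShaped m D
IsHookDiagram⇒HookShaped (r₁ , r₂ , c , cs , _ , _ , _ , _ , D⪯Hook) =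
  maxList c cs , ⪯-HookShaped (Hook-HookShaped r₁ r₂ c cs) D⪯Hook

pos∸suc< : ∀ n s → 1 ≤ n ∸ suc s → n ∸ suc s < n
pos∸suc< (suc n) s _ = s≤s (m∸n≤m n s)

lemma4p7 : (D D' : Diagram) (r c k : ℕ) → IsHookDiagram D → 1 ≤ k
           → Kohnert D r c (r ∸ k) D' → CoveredBy D' D → k ≡ 1
lemma4p7 D D' r       c (suc zero)     _    _ _ _   = refl
lemma4p7 D D' zero    c (suc (suc k')) _    _ K _   with () ← Kohnert.target-pos K
lemma4p7 D D' (suc n) c (suc (suc k')) hook _ K cov =
  ⊥-elim (Kohnert-skip⇒¬CoveredBy K t<n rightmost-below cov)
  where
  open Kohnert K
  t<n : n ∸ suc k' < n
  t<n = pos∸suc< n k' target-pos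
  rightmost-below : ∀ c' → c < c' → (n , c') ∉ D
  rightmost-below with _ , H ← IsHookDiagram⇒HookShaped hook =
    HookShaped.no-cell-right-of-double H (<⇒≢ (n<1+n n))
      (target-max n t<n (n<1+n n)) cell-in
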